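{- Let $F:S_n\to S_n$ be a homing shuffle, $w\in S_n$, and $k:=w(1)$. Then: (a) $F(w)([i,j])=w([i,j])$ for all $k<i\le j\le n$; (b) $F(w)([i])=w([i])$ for all $i\ge k$ (with $i\le n$); (c) $F(w)([k-1])=w([k])\setminus\{k\}$.
   Context: $[n]=\{1,\dots,n\}$, $[a,b]=\{a,\dots,b\}$; $S_n$ is the group of bijections $[n]\to[n]$. A homing shuffle is a map $F:S_n\to S_n$ such that for every $w\in S_n$, setting $k:=w(1)$: (a) $F(w)(k)=k$, and (b) $F(w)(i)=w(i)$ for all $i>k$. -}

module Defs where

open import Data.Nat using (ℕ; suc; _≤_; _<_)
open import Data.Fin using (Fin; toℕ; zero)
open import Data.Fin.Permutation using (Permutation′; _⟨$⟩ʳ_)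
open import Data.Product using (Σ; _×_)
open import Relation.Binary.PropositionalEquality using (_≡_; _≢_)

-- Convention: [n] = {1,…,n} is modelled by Fin n, with x : Fin n
-- standing for the number  num x = toℕ x + 1.
num : ∀ {n} → Fin n → ℕ
num x = suc (toℕ x)

S : ℕ → Set
S n = Permutation′ n

-- k := w(1) (needs n ≥ 1, so we work in S (suc m)).
first : ∀ {m} → S (suc m) → Fin (suc m)
first w = w ⟨$⟩ʳ zero

IsHomingShuffle : ∀ {m} → (S (suc m) → S (suc m)) → Set
IsHomingShuffle {m} F =
  (w : S (suc m)) →
    (F w ⟨$⟩ʳ first w ≡ first w) ×
    ((i : Fin (suc m)) → num (first w) < num i → F w ⟨$⟩ʳ i ≡ w ⟨$⟩ʳ i)

InImage : ∀ {n} → S n → ℕ → ℕ → Fin n → Set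
InImage {n} σ i j v = Σ (Fin n) λ p → (i ≤ num p) × (num p ≤ j) × (σ ⟨$⟩ʳ p ≡ v)

SameImage : ∀ {n} → S n → S n → ℕ → ℕ → Set
SameImage {n} σ τ i j =
  (v : Fin n) → (InImage σ i j v → InImage τ i j v) × (InImage τ i j v → InImage σ i j v)

module Submission where

open import Defs
open import Data.Empty using (⊥-elim)
open import Data.Fin using (Fin)
open import Data.Fin.Permutation using (_⟨$⟩ʳ_; _⟨$⟩ˡ_; inverseʳ)
open import Data.Fin.Properties using (toℕ-injective)
open import Data.Nat using (ℕ; suc; _≤_; _<_; _∸_; s≤s; z≤n)
open import Data.Nat.Properties
  using (≤-refl; ≤-trans; <-≤-trans; n≤1+n; <-irrefl; ≰⇒>; <⇒≱; _≤?_; <⇒≤pred; ≤∧≢⇒<; suc-injective)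
open import Data.Product using (_×_; _,_; proj₁; proj₂)
open import Function.Base using (_∘_)
open import Function.Bundles using (Injection)
open import Function.Properties.Inverse using (↔⇒↣)
open import Relation.Binary.PropositionalEquality using (_≡_; _≢_; refl; sym; trans; cong; subst)
open import Relation.Nullary using (yes; no)

variable
  n : ℕ

⟨$⟩ʳ-injective : (σ : S n) {p q : Fin n} → σ ⟨$⟩ʳ p ≡ σ ⟨$⟩ʳ q → p ≡ q
⟨$⟩ʳ-injective σ = Injection.injective (↔⇒↣ σ)

num-injective : {p q : Fin n} → num p ≡ num q → p ≡ q
num-injective = toℕ-injective ∘ suc-injective

record AgreeAbove (k : ℕ) (σ τ : S n) : Set where
  constructor agreeAbove
  field agreeAt : (p : Fin n) → k < num p → σ ⟨$⟩ʳ p ≡ τ ⟨$⟩ʳ p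
open AgreeAbove

AgreeAbove-sym : {k : ℕ} {σ τ : S n} → AgreeAbove k σ τ → AgreeAbove k τ σ
AgreeAbove-sym agree = agreeAbove λ p k<p → sym (agreeAt agree p k<p)

InImage-agreeAbove : {k i j : ℕ} {σ τ : S n} → AgreeAbove k σ τ → k < i →
  (v : Fin n) → InImage σ i j v → InImage τ i j v
InImage-agreeAbove agree k<i v (p , i≤p , p≤j , σp≡v) =
  p , i≤p , p≤j , trans (sym (agreeAt agree p (<-≤-trans k<i i≤p))) σp≡v

sameImage-agreeAbove : {k i j : ℕ} {σ τ : S n} → AgreeAbove k σ τ → k < i → SameImage σ τ i j
sameImage-agreeAbove agree k<i v =
  InImage-agreeAbove agree k<i v , InImage-agreeAbove (AgreeAbove-sym agree) k<i v

-- If τ⁻¹ v lay beyond i, then τ and σ would agree there, so σ would take the value v twice.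
InImage-prefix-agreeAbove : {k i : ℕ} {σ τ : S n} → AgreeAbove k σ τ → k ≤ i →
  (v : Fin n) → InImage σ 1 i v → InImage τ 1 i v
InImage-prefix-agreeAbove {i = i} {σ} {τ} agree k≤i v (p , _ , p≤i , σp≡v)
  with num (τ ⟨$⟩ˡ v) ≤? i
... | yes q≤i = τ ⟨$⟩ˡ v , s≤s z≤n , q≤i , inverseʳ τ
... | no q≰i = ⊥-elim (<⇒≱ (subst (λ x → i < num x) q≡p i<q) p≤i)
  where
  i<q : i < num (τ ⟨$⟩ˡ v)
  i<q = ≰⇒> q≰i
  q≡p : τ ⟨$⟩ˡ v ≡ p
  q≡p = ⟨$⟩ʳ-injective σ
    (trans (agreeAt agree _ (<-≤-trans (s≤s k≤i) i<q)) (trans (inverseʳ τ) (sym σp≡v)))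

sameImage-prefix-agreeAbove : {k i : ℕ} {σ τ : S n} → AgreeAbove k σ τ → k ≤ i →
  SameImage σ τ 1 i
sameImage-prefix-agreeAbove agree k≤i v =
  InImage-prefix-agreeAbove agree k≤i v , InImage-prefix-agreeAbove (AgreeAbove-sym agree) k≤i v

InImage-below⇒ : (σ : S n) (x v : Fin n) →
  InImage σ 1 (num x ∸ 1) v → InImage σ 1 (num x) v × v ≢ σ ⟨$⟩ʳ x
InImage-below⇒ σ x v (p , _ , p<x , σp≡v) =
  (p , s≤s z≤n , ≤-trans p<x (n≤1+n _) , σp≡v) , v≢σx
  where
  v≢σx : v ≢ σ ⟨$⟩ʳ x
  v≢σx v≡σx = <-irrefl refl (subst (λ y → num y ≤ num x ∸ 1)
    (⟨$⟩ʳ-injective σ (trans σp≡v v≡σx)) p<x)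

InImage-below⇐ : (σ : S n) (x v : Fin n) →
  InImage σ 1 (num x) v × v ≢ σ ⟨$⟩ʳ x → InImage σ 1 (num x ∸ 1) v
InImage-below⇐ σ x v ((p , _ , p≤x , σp≡v) , v≢σx) =
  p , s≤s z≤n , <⇒≤pred (≤∧≢⇒< p≤x p≢x) , σp≡v
  where
  p≢x : num p ≢ num x
  p≢x eq = v≢σx (trans (sym σp≡v) (cong (σ ⟨$⟩ʳ_) (num-injective eq)))

proposition1 : ∀ {m} (F : S (suc m) → S (suc m)) → IsHomingShuffle F →
    (w : S (suc m)) →
      ((i j : ℕ) → num (first w) < i → i ≤ j → j ≤ suc m → SameImage (F w) w i j)
      × ((i : ℕ) → num (first w) ≤ i → i ≤ suc m → SameImage (F w) w 1 i)
      × ((v : Fin (suc m)) →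
           (InImage (F w) 1 (num (first w) ∸ 1) v → InImage w 1 (num (first w)) v × v ≢ first w)
           × (InImage w 1 (num (first w)) v × v ≢ first w → InImage (F w) 1 (num (first w) ∸ 1) v))
proposition1 F homing w =
    (λ _ _ k<i _ _ → sameImage-agreeAbove agree k<i)
  , (λ _ k≤i _ → sameImage-prefix-agreeAbove agree k≤i)
  , λ v → imageBelow-k⇒ v , imageBelow-k⇐ v
  where
  k : Fin (suc _)
  k = first w
  fixes : F w ⟨$⟩ʳ k ≡ k
  fixes = proj₁ (homing w)
  agree : AgreeAbove (num k) (F w) w
  agree = agreeAbove (proj₂ (homing w))
  -- F w fixes k and maps [k] onto w([k]); so [k-1] goes onto w([k]) minus the value k.
  imageBelow-k⇒ : ∀ v → InImage (F w) 1 (num k ∸ 1) v → InImage w 1 (num k) v × v ≢ k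
  imageBelow-k⇒ v im with InImage-below⇒ (F w) k v im
  ... | im′ , v≢Fk =
    InImage-prefix-agreeAbove agree ≤-refl v im′ , λ v≡k → v≢Fk (trans v≡k (sym fixes))
  imageBelow-k⇐ : ∀ v → InImage w 1 (num k) v × v ≢ k → InImage (F w) 1 (num k ∸ 1) v
  imageBelow-k⇐ v (im , v≢k) = InImage-below⇐ (F w) k v
    (InImage-prefix-agreeAbove (AgreeAbove-sym agree) ≤-refl v im , λ v≡Fk → v≢k (trans v≡Fk fixes))
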